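{- Let $d$ be a nonnegative integer. (i) Let $V$ be a finite set with $|V| = n$, let $r$ be a nonnegative integer with $d + r \le n$, and let $K$ be a $d$-collapsible simplicial complex on $V$ with $\dim(K) \le d + r - 1$. Let $H$ be the $(d+1)$-uniform hypergraph on $V$ whose edges are exactly the $(d+1)$-element subsets of $V$ that are not faces of $K$. Then $H$ is weakly $K^{(d+1)}_{\mathbf m}$-saturated in the complete $(d+1)$-uniform hypergraph $K^{(d+1)}_n$ on $V$, where $\mathbf m = (1, \ldots, 1, n - d - r + 1)$ is the $(d+1)$-tuple whose first $d$ entries equal $1$ and whose last entry equals $n-d-r+1$. (ii) Let $V$ be a finite set with a partition $V = V_1 \cup \cdots \cup V_{d+1}$, and let $r_1, \ldots, r_{d+1}$ be nonnegative integers such that $|V_i| = n_i \ge r_i$ for every $i \in [d+1]$; write $\mathbf n = (n_1, \ldots, n_{d+1})$. Let $K$ be a $d$-collapsible simplicial complex on $V$ with $\dim(K[V_i]) \le r_i - 1$ for every $i \in [d+1]$. Let $H$ be the $(d+1)$-partite $(d+1)$-uniform hypergraph with vertex partition $(V_1, \ldots, V_{d+1})$ whose edges are exactly the rainbow sets of size $d+1$ (i.e., sets containing exactly one element from each $V_i$) that are not faces of $K$. For every $i \in [d+1]$, let $\mathbf m_i = (1, \ldots, 1, n_i - r_i + 1, 1, \ldots, 1)$ be the $(d+1)$-tuple whose $i$-th entry is $n_i - r_i + 1$ and all other entries equal $1$. Then $H$ is directed weakly $\{K^{(d+1)}_{\mathbf m_1}, \ldots, K^{(d+1)}_{\mathbf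 m_{d+1}}\}$-saturated in the host hypergraph $K^{(d+1)}_{\mathbf n}$ with vertex partition $(V_1, \ldots, V_{d+1})$.
   Context: Simplicial complexes are abstract simplicial complexes on a finite vertex set; $\dim\sigma := |\sigma| - 1$ and $\dim(K) := \max_{\sigma\in K} \dim \sigma$; $K[W]$ denotes the subcomplex of faces of $K$ contained in $W$. An elementary $d$-collapse in $K$ is the operation of choosing a face $\sigma$ of size at most $d$ that is contained in a unique maximal face of $K$ and deleting all faces of $K$ containing $\sigma$. $K$ is $d$-collapsible if all faces can be removed by a finite sequence of elementary $d$-collapses. An $r$-graph is an $r$-uniform hypergraph. $K^{(r)}_n$ denotes the complete $r$-graph on $n$ vertices. For a tuple $\mathbf m = (m_1, \ldots, m_r)$ of positive integers, $K^{(r)}_{\mathbf m}$ denotes the complete $r$-partite $r$-graph with vertex partition $(U_1, \ldots, U_r)$, $|U_i| = m_i$ (edges: all sets with exactly one vertex in each $U_i$). For hypergraphs $H \subseteq G$ on the same vertex set and $H \cup \{e_1,\dots,e_k\}$ denoting $H$ with edges $e_1,\dots,e_k$ added, and a family $\mathcal F$ of hypergraphs, $H$ is weakly $\mathcal F$-saturated in $G$ if there is an ordering $e_1, \ldots, e_m$ of $E(G) \setminus E(H)$ such that for every $k \in [m]$, $H \cup \{e_1, \ldots, e_k\}$ contains a copy of some member of $\mathcal F$ that uses the edge $e_k$ (for a single hypergraph $F$, weakly $F$-saturated means weakly $\{F\}$-saturated). In the $r$-partite setting, where $G, H$ have a fixed vertex partition $(V_1, \ldots, V_r)$ and each $F \in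 \mathcal F$ has a fixed partition $(U_1, \ldots, U_r)$, a copy of $F$ is directed if its embedding $\varphi$ satisfies $\varphi(U_i) \subseteq V_i$ for all $i$; $H$ is directed weakly $\mathcal F$-saturated if such an ordering exists where at each step the copy containing $e_k$ is a directed copy of some member of $\mathcal F$. -}

module Defs where

open import Level using (0ℓ)
open import Data.Nat using (ℕ; zero; suc; _+_; _≤_)
open import Data.Fin as Fin using (Fin; zero; suc; splitAt; _≟_)
open import Data.Fin.Properties using (any?)
open import Data.Fin.Subset using (Subset; _∩_; _⊆_; ∣_∣)
open import Data.Fin.Subset.Properties using (_∈?_)
open import Data.Vec as Vec using (Vec; []; _∷_; tabulate)
open import Data.List using (List; []; _∷_)
open import Data.List.Membership.Propositional using (_∈_)
open import Data.List.Relation.Unary.Unique.Propositional using (Unique)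
open import Data.Product using (Σ; ∃; _×_; _,_)
open import Data.Sum using (_⊎_; inj₁; inj₂)
open import Relation.Nullary using (¬_; does)
open import Relation.Nullary.Decidable using (_×-dec_)
open import Relation.Binary.PropositionalEquality using (_≡_)
open import Function using (Injective; _⇔_)

image : ∀ {m n} → (Fin m → Fin n) → Subset m → Subset n
image φ s = tabulate (λ j → does (any? (λ i → (i ∈? s) ×-dec (φ i ≟ j))))

record SimplicialComplex (n : ℕ) : Set₁ where
  field
    face   : Subset n → Set
    closed : ∀ σ τ → τ ⊆ σ → face σ → face τ
open SimplicialComplex public

Faces : ℕ → Set₁
Faces n = Subset n → Set

Maximal : ∀ {n} → Faces n → Subset n → Set
Maximal K τ = K τ × (∀ ρ → K ρ → τ ⊆ ρ → ρ ≡ τ)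

InUniqueMaximal : ∀ {n} → Faces n → Subset n → Set
InUniqueMaximal K σ =
  Σ (Subset _) λ τ → (Maximal K τ × σ ⊆ τ)
                   × (∀ τ' → Maximal K τ' → σ ⊆ τ' → τ' ≡ τ)

deleteStar : ∀ {n} → Faces n → Subset n → Faces n
deleteStar K σ τ = K τ × ¬ (σ ⊆ τ)

data Collapsible (d : ℕ) {n : ℕ} : Faces n → Set₁ where
  done : ∀ {K} → (∀ σ → ¬ K σ) → Collapsible d K
  step : ∀ {K} σ → K σ → ∣ σ ∣ ≤ d → InUniqueMaximal K σ →
         Collapsible d (deleteStar K σ) → Collapsible d K

DCollapsible : ∀ (d : ℕ) {n} → SimplicialComplex n → Set₁
DCollapsible d K = Collapsible d (face K)

Hypergraph : ℕ → Set₁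
Hypergraph n = Subset n → Set

_+ₑ_ : ∀ {n} → Hypergraph n → Subset n → Hypergraph n
(H +ₑ e) f = H f ⊎ f ≡ e

Complete : (r n : ℕ) → Hypergraph n
Complete r n e = ∣ e ∣ ≡ r

part : ∀ {n r} → (Fin n → Fin r) → Fin r → Subset n
part lab i = tabulate (λ x → does (lab x ≟ i))

Rainbow : ∀ {n r} → (Fin n → Fin r) → Subset n → Set
Rainbow lab e = ∀ i → ∣ e ∩ part lab i ∣ ≡ 1

-- Standard labelling of Fin (m₁ + ... + m_r): first m₁ vertices in U₁, etc.
label : ∀ {r} (m : Vec ℕ r) → Fin (Vec.sum m) → Fin r
label (a ∷ m) x with splitAt a x
... | inj₁ _ = zero
... | inj₂ y = suc (label m y)

CompletePartite : ∀ {r} (m : Vec ℕ r) → Hypergraph (Vec.sum m)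
CompletePartite m = Rainbow (label m)

record CopyUsing {N n} (F : Hypergraph N) (G : Hypergraph n) (e : Subset n) : Set where
  field
    φ     : Fin N → Fin n
    inj   : Injective _≡_ _≡_ φ
    edges : ∀ f → F f → G (image φ f)
    uses  : Σ (Subset N) λ f → F f × image φ f ≡ e

record DirectedCopyUsing {N n r} (F : Hypergraph N) (labF : Fin N → Fin r)
                         (G : Hypergraph n) (labG : Fin n → Fin r)
                         (e : Subset n) : Set where
  field
    copy     : CopyUsing F G e
    directed : ∀ x → labG (CopyUsing.φ copy x) ≡ labF x

SatSteps : ∀ {n} {I : Set} (N : I → ℕ) (F : (i : I) → Hypergraph (N i)) →
           Hypergraph n → List (Subset n) → Set
SatSteps N F H [] = Data.Unit.⊤ where import Data.Unit
SatSteps N F H (e ∷ es) =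
  (∃ λ i → CopyUsing (F i) (H +ₑ e) e) × SatSteps N F (H +ₑ e) es

WeaklySaturated : ∀ {n} {I : Set} (N : I → ℕ) (F : (i : I) → Hypergraph (N i)) →
                  (H G : Hypergraph n) → Set
WeaklySaturated {n} N F H G =
  Σ (List (Subset n)) λ es →
    Unique es × (∀ e → (e ∈ es) ⇔ (G e × ¬ H e)) × SatSteps N F H es

DirSatSteps : ∀ {n r} {I : Set} (N : I → ℕ) (F : (i : I) → Hypergraph (N i))
              (labF : (i : I) → Fin (N i) → Fin r) (labG : Fin n → Fin r) →
              Hypergraph n → List (Subset n) → Set
DirSatSteps N F labF labG H [] = Data.Unit.⊤ where import Data.Unit
DirSatSteps N F labF labG H (e ∷ es) =
  (∃ λ i → DirectedCopyUsing (F i) (labF i) (H +ₑ e) labG e)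
  × DirSatSteps N F labF labG (H +ₑ e) es

DirectedWeaklySaturated :
  ∀ {n r} {I : Set} (N : I → ℕ) (F : (i : I) → Hypergraph (N i))
  (labF : (i : I) → Fin (N i) → Fin r) (labG : Fin n → Fin r) →
  (H G : Hypergraph n) → Set
DirectedWeaklySaturated {n} N F labF labG H G =
  Σ (List (Subset n)) λ es →
    Unique es × (∀ e → (e ∈ es) ⇔ (G e × ¬ H e)) × DirSatSteps N F labF labG H es

{-# OPTIONS --safe #-}
module Submission where

-- The collapse sequence of K is followed backwards. If σ is the first collapsed face, τ the unique
-- maximal face containing it and K′ = K minus the star of σ, then G ∖ K′ is G ∖ K together with the
-- host edges e such that σ ⊆ e ⊆ τ. Adding these first and then the sequence for G ∖ K′ (induction),
-- it remains to find, for each such e, a copy of the pattern in (G ∖ K) + e using e. As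
-- ∣ σ ∣ ≤ d < ∣ e ∣ there is w ∈ e ∖ σ; the copy is the sunflower with core e − w whose petals are w
-- and k vertices outside τ, which exist because τ is a face (k = n − d − r, resp. ∣ V_c ∣ − r_c for
-- the part c of w). Each petal edge other than e contains σ but is not inside τ, so it is not a face.

open import Defs
open import Data.Nat using (ℕ; zero; suc; _+_; _∸_; _≤_; _<_; z≤n; s≤s)
open import Data.Nat.Properties
  using (<⇒≱; ≤-<-trans; ≤-reflexive; +-suc; +-comm; n<1⇒n≡0; ∸-+-assoc; ∸-monoʳ-≤; m+n∸m≡n; module ≤-Reasoning)
import Data.Nat.Properties as ℕ
open import Data.Fin using (Fin; zero; suc; _≟_; toℕ; fromℕ; inject≤; fromℕ<; splitAt; _↑ˡ_; _↑ʳ_)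
open import Data.Fin.Properties
  using ( any?; all?; ¬Fin0; suc-injective; inject≤-injective; toℕ<n; toℕ-injective; toℕ-fromℕ<
        ; 0≢1+n; splitAt-↑ˡ; splitAt-↑ʳ; splitAt⁻¹-↑ˡ; splitAt⁻¹-↑ʳ)
open import Data.Fin.Subset
  using (Subset; inside; outside; _∈_; _∉_; _⊆_; _⊃_; _∩_; ∁; _-_; ⁅_⁆; ⊥; ∣_∣)
import Data.Fin.Subset as Subset
open import Data.Fin.Subset.Properties
  using ( _∈?_; ⊆-antisym; ⊆-trans; ∈⊤; Empty-unique; ∣⊥∣≡0; p─⊥≡p; x∈p∧x≢y⇒x∈p-y
        ; _⊆?_; p─q⊆p; p⊆q⇒∣p∣≤∣q∣; x∈p⇒∣p-x∣<∣p∣; x∈p∩q⁺; x∈p∩q⁻; x∈⁅x⁆; x∈⁅y⁆⇒x≡y; ∣⁅x⁆∣≡1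
        ; x∈∁p⇒x∉p; ∣∁p∣≡n∸∣p∣; p∩q⊆p; p∩q⊆q)
open import Data.Vec as Vec using (Vec; []; _∷_; here; there; tabulate; lookup; replicate; _[_]≔_; _∷ʳ_)
open import Data.Vec.Properties
  using (∷-injective; lookup∘tabulate; []=⇒lookup; lookup⇒[]=; lookup∘update; lookup∘update′; lookup-replicate)
open import Data.Vec.Functional.Properties using (updateAt-updates; updateAt-minimal)
import Data.Vec.Functional as Vector
open Vector using (updateAt)
open import Data.List using (List; []; _∷_; _++_; map; filter; foldl)
open import Data.List.Membership.Propositional using () renaming (_∈_ to _∈ₗ_)
open import Data.List.Membership.Propositional.Properties
  using (∈-map⁺; ∈-map⁻; ∈-++⁺ˡ; ∈-++⁺ʳ; ∈-++⁻; ∈-filter⁺; ∈-filter⁻)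
open import Data.List.Relation.Unary.Any using (here; there)
open import Data.List.Relation.Unary.All using ([])
open import Data.List.Relation.Unary.Unique.Propositional using (Unique; []; _∷_)
import Data.List.Relation.Unary.Unique.Propositional.Properties as Unique
open import Data.Unit using (⊤)
open import Data.Product using (Σ; ∃; _×_; _,_; proj₁; proj₂)
open import Data.Sum using (_⊎_; inj₁; inj₂; [_,_]′)
open import Data.Empty using (⊥-elim)
open import Relation.Nullary using (¬_; yes; no; does; contradiction)
open import Relation.Nullary.Decidable using (_×-dec_; ¬?; dec-true; decidable-stable)
open import Relation.Unary using (Pred; Decidable)
open import Data.Fin.Subset.Induction using (Acc; acc; ⊃-wellFounded)
open import Data.Fin.Permutation.Components using (transpose; transpose-inverse)
open import Relation.Binary.PropositionalEquality
open import Function using (Injective; id; const; _∘_; case_of_; _⇔_; mk⇔; Equivalence)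
open import Level using (0ℓ)

private variable
  n N R k : ℕ

module _ {P : Pred (Fin n) 0ℓ} (P? : Decidable P) where

  ∈-tabulate⁺ : ∀ {y} → P y → y ∈ tabulate (does ∘ P?)
  ∈-tabulate⁺ {y} Py = lookup⇒[]= y _ (trans (lookup∘tabulate _ y) (dec-true (P? y) Py))

  ∈-tabulate⁻ : ∀ {y} → y ∈ tabulate (does ∘ P?) → P y
  ∈-tabulate⁻ {y} y∈ with P? y | trans (sym (lookup∘tabulate (does ∘ P?) y)) ([]=⇒lookup y∈)
  ... | yes Py | _ = Py
  ... | no _ | ()

∈-part⁺ : ∀ {r} (lab : Fin n → Fin r) {i x} → lab x ≡ i → x ∈ part lab i
∈-part⁺ lab {i} = ∈-tabulate⁺ (λ x → lab x ≟ i)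

∈-part⁻ : ∀ {r} (lab : Fin n → Fin r) {i x} → x ∈ part lab i → lab x ≡ i
∈-part⁻ lab {i} = ∈-tabulate⁻ (λ x → lab x ≟ i)

module _ (φ : Fin N → Fin n) {s : Subset N} where

  ∈-image⁺ : ∀ {x} → x ∈ s → φ x ∈ image φ s
  ∈-image⁺ {x} x∈s = ∈-tabulate⁺ (λ y → any? (λ x → (x ∈? s) ×-dec (φ x ≟ y))) (x , x∈s , refl)

  ∈-image⁻ : ∀ {y} → y ∈ image φ s → ∃ λ x → x ∈ s × φ x ≡ y
  ∈-image⁻ = ∈-tabulate⁻ (λ y → any? (λ x → (x ∈? s) ×-dec (φ x ≟ y)))

range : (Fin R → Fin n) → Subset n
range f = image f Subset.⊤

module _ (f : Fin R → Fin n) where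

  ∈-range⁺ : ∀ j → f j ∈ range f
  ∈-range⁺ j = ∈-image⁺ f ∈⊤

  ∈-range⁻ : ∀ {y} → y ∈ range f → ∃ λ j → f j ≡ y
  ∈-range⁻ y∈ with ∈-image⁻ f y∈
  ... | j , _ , fj≡y = j , fj≡y

  range-unique : ∀ {s} → (∀ j → f j ∈ s) → (∀ {y} → y ∈ s → ∃ λ j → f j ≡ y) → range f ≡ s
  range-unique f∈s onto = ⊆-antisym
    (λ y∈ → let j , fj≡y = ∈-range⁻ y∈ in subst (_∈ _) fj≡y (f∈s j))
    (λ y∈ → let j , fj≡y = onto y∈ in subst (_∈ range f) fj≡y (∈-range⁺ j))

range-cong : {f g : Fin R → Fin n} → (∀ j → f j ≡ g j) → range f ≡ range g
range-cong {f = f} {g} f≗g = range-unique f (λ j → subst (_∈ range g) (sym (f≗g j)) (∈-range⁺ g j))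
  (λ y∈ → let j , gj≡y = ∈-range⁻ g y∈ in j , trans (f≗g j) gj≡y)

range-∘ : (f : Fin R → Fin n) {π : Fin R → Fin R} → (∀ j → ∃ λ i → π i ≡ j) → range (f ∘ π) ≡ range f
range-∘ f {π} π-onto = range-unique (f ∘ π) (λ i → ∈-range⁺ f (π i))
  (λ y∈ → let j , fj≡y = ∈-range⁻ f y∈ ; i , πi≡j = π-onto j in i , trans (cong f πi≡j) fj≡y)

image-range : (φ : Fin N → Fin n) (f : Fin R → Fin N) → image φ (range f) ≡ range (φ ∘ f)
image-range φ f = ⊆-antisym
  (λ y∈ → let x , x∈ , φx≡y = ∈-image⁻ φ y∈ ; j , fj≡x = ∈-range⁻ f x∈ in
          subst (_∈ range (φ ∘ f)) (trans (cong φ fj≡x) φx≡y) (∈-range⁺ (φ ∘ f) j))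
  (λ y∈ → let j , φfj≡y = ∈-range⁻ (φ ∘ f) y∈ in
          subst (_∈ image φ (range f)) φfj≡y (∈-image⁺ φ (∈-range⁺ f j)))

∣p∣≡1+∣p-x∣ : ∀ (p : Subset n) {x} → x ∈ p → ∣ p ∣ ≡ suc ∣ p - x ∣
∣p∣≡1+∣p-x∣ (inside ∷ p) {zero} _ = cong (suc ∘ ∣_∣) (sym (p─⊥≡p p))
∣p∣≡1+∣p-x∣ (inside ∷ p) {suc x} (there x∈p) = cong suc (∣p∣≡1+∣p-x∣ p x∈p)
∣p∣≡1+∣p-x∣ (outside ∷ p) {suc x} (there x∈p) = ∣p∣≡1+∣p-x∣ p x∈p

x∈p-y⇒x≢y : ∀ (p : Subset n) {x} y → x ∈ p - y → x ≢ y
x∈p-y⇒x≢y (inside ∷ p) zero () refl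
x∈p-y⇒x≢y (outside ∷ p) zero () refl
x∈p-y⇒x≢y (_ ∷ p) (suc y) (there x∈p-y) refl = x∈p-y⇒x≢y p y x∈p-y refl

∣range∣≡R : (f : Fin R → Fin n) → Injective _≡_ _≡_ f → ∣ range f ∣ ≡ R
∣range∣≡R {zero} {n} f _ = trans (cong ∣_∣ (Empty-unique λ (y , y∈) → ¬Fin0 (proj₁ (∈-range⁻ f y∈)))) (∣⊥∣≡0 n)
∣range∣≡R {suc R} f f-inj = trans (∣p∣≡1+∣p-x∣ (range f) (∈-range⁺ f zero)) (cong suc (begin
  ∣ range f - f zero ∣   ≡⟨ cong ∣_∣ (sym range-tail) ⟩
  ∣ range (f ∘ suc) ∣    ≡⟨ ∣range∣≡R (f ∘ suc) (suc-injective ∘ f-inj) ⟩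
  R                      ∎))
  where
  open ≡-Reasoning
  range-tail : range (f ∘ suc) ≡ range f - f zero
  range-tail = range-unique (f ∘ suc)
    (λ j → x∈p∧x≢y⇒x∈p-y (∈-range⁺ f (suc j)) (λ eq → 0≢1+n (f-inj (sym eq))))
    λ {y} y∈ → case ∈-range⁻ f (p─q⊆p _ _ y∈) of λ where
      (zero , f0≡y) → contradiction (sym f0≡y) (x∈p-y⇒x≢y (range f) (f zero) y∈)
      (suc j , fj≡y) → j , fj≡y

∣p∣≡0⇒p≡⊥ : ∀ (p : Subset n) → ∣ p ∣ ≡ 0 → p ≡ ⊥
∣p∣≡0⇒p≡⊥ [] _ = refl
∣p∣≡0⇒p≡⊥ (outside ∷ p) ∣p∣≡0 = cong (outside ∷_) (∣p∣≡0⇒p≡⊥ p ∣p∣≡0)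

∣p∣≡1⇒p≡⁅x⁆ : ∀ (p : Subset n) → ∣ p ∣ ≡ 1 → ∃ λ x → p ≡ ⁅ x ⁆
∣p∣≡1⇒p≡⁅x⁆ (inside ∷ p) ∣p∣≡1 = zero , cong (inside ∷_) (∣p∣≡0⇒p≡⊥ p (ℕ.suc-injective ∣p∣≡1))
∣p∣≡1⇒p≡⁅x⁆ (outside ∷ p) ∣p∣≡1 =
  let x , p≡⁅x⁆ = ∣p∣≡1⇒p≡⁅x⁆ p ∣p∣≡1 in suc x , cong (outside ∷_) p≡⁅x⁆

∣p∣≡∣p∩q∣+∣p∩∁q∣ : ∀ (p q : Subset n) → ∣ p ∣ ≡ ∣ p ∩ q ∣ + ∣ p ∩ ∁ q ∣
∣p∣≡∣p∩q∣+∣p∩∁q∣ [] [] = refl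
∣p∣≡∣p∩q∣+∣p∩∁q∣ (inside ∷ p) (inside ∷ q) = cong suc (∣p∣≡∣p∩q∣+∣p∩∁q∣ p q)
∣p∣≡∣p∩q∣+∣p∩∁q∣ (inside ∷ p) (outside ∷ q) =
  trans (cong suc (∣p∣≡∣p∩q∣+∣p∩∁q∣ p q)) (sym (+-suc _ _))
∣p∣≡∣p∩q∣+∣p∩∁q∣ (outside ∷ p) (_ ∷ q) = ∣p∣≡∣p∩q∣+∣p∩∁q∣ p q

∣p∩q∣≤b⇒∣p∣∸b≤∣p∩∁q∣ : ∀ (p q : Subset n) {b} → ∣ p ∩ q ∣ ≤ b → ∣ p ∣ ∸ b ≤ ∣ p ∩ ∁ q ∣
∣p∩q∣≤b⇒∣p∣∸b≤∣p∩∁q∣ p q {b} ∣p∩q∣≤b = begin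
  ∣ p ∣ ∸ b                              ≤⟨ ∸-monoʳ-≤ ∣ p ∣ ∣p∩q∣≤b ⟩
  ∣ p ∣ ∸ ∣ p ∩ q ∣                      ≡⟨ cong (_∸ ∣ p ∩ q ∣) (∣p∣≡∣p∩q∣+∣p∩∁q∣ p q) ⟩
  ∣ p ∩ q ∣ + ∣ p ∩ ∁ q ∣ ∸ ∣ p ∩ q ∣    ≡⟨ m+n∸m≡n ∣ p ∩ q ∣ ∣ p ∩ ∁ q ∣ ⟩
  ∣ p ∩ ∁ q ∣                            ∎
  where open ≤-Reasoning

⊆⊎∃∉ : ∀ (p q : Subset n) → p ⊆ q ⊎ ∃ λ x → x ∈ p × x ∉ q
⊆⊎∃∉ p q with any? (λ x → (x ∈? p) ×-dec ¬? (x ∈? q))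
... | yes escape = inj₂ escape
... | no ¬escape = inj₁ λ {x} x∈p → decidable-stable (x ∈? q) (λ x∉q → ¬escape (x , x∈p , x∉q))

∣p∣<∣q∣⇒∃∈q─p : ∀ {p q : Subset n} → ∣ p ∣ < ∣ q ∣ → ∃ λ x → x ∈ q × x ∉ p
∣p∣<∣q∣⇒∃∈q─p {p = p} {q} ∣p∣<∣q∣ with ⊆⊎∃∉ q p
... | inj₁ q⊆p = contradiction (p⊆q⇒∣p∣≤∣q∣ q⊆p) (<⇒≱ ∣p∣<∣q∣)
... | inj₂ escape = escape

p⊆q∧∣q∣≤∣p∣⇒p≡q : ∀ {p q : Subset n} → p ⊆ q → ∣ q ∣ ≤ ∣ p ∣ → p ≡ q
p⊆q∧∣q∣≤∣p∣⇒p≡q {p = p} {q} p⊆q ∣q∣≤∣p∣ with ⊆⊎∃∉ q p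
... | inj₁ q⊆p = ⊆-antisym p⊆q q⊆p
... | inj₂ (x , x∈q , x∉p) = contradiction ∣q∣≤∣p∣ (<⇒≱ (≤-<-trans (p⊆q⇒∣p∣≤∣q∣ p⊆q-x) (x∈p⇒∣p-x∣<∣p∣ x∈q)))
  where
  p⊆q-x : p ⊆ q - x
  p⊆q-x y∈p = x∈p∧x≢y⇒x∈p-y (p⊆q y∈p) (λ { refl → x∉p y∈p })

injective-∷ : ∀ {x} {g : Fin k → Fin n} → Injective _≡_ _≡_ g → (∀ i → g i ≢ x) →
              Injective _≡_ _≡_ (x Vector.∷ g)
injective-∷ g-inj g≢x {zero} {zero} _ = refl
injective-∷ g-inj g≢x {zero} {suc j} x≡gj = contradiction (sym x≡gj) (g≢x j)
injective-∷ g-inj g≢x {suc i} {zero} gi≡x = contradiction gi≡x (g≢x i)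
injective-∷ g-inj g≢x {suc i} {suc j} gi≡gj = cong suc (g-inj gi≡gj)

embedding : (s : Subset n) → Σ (Fin ∣ s ∣ → Fin n) λ f → Injective _≡_ _≡_ f × ∀ j → f j ∈ s
embedding [] = (λ ()) , (λ {i} → contradiction i ¬Fin0) , λ ()
embedding (outside ∷ s) =
  let f , f-inj , f∈s = embedding s in suc ∘ f , f-inj ∘ suc-injective , λ j → there (f∈s j)
embedding (inside ∷ s) =
  let f , f-inj , f∈s = embedding s in
  zero Vector.∷ (suc ∘ f) , injective-∷ (f-inj ∘ suc-injective) (λ i ()) ,
  λ { zero → here ; (suc j) → there (f∈s j) }

choose : ∀ {X : Subset n} → k ≤ ∣ X ∣ → Σ (Fin k → Fin n) λ g → Injective _≡_ _≡_ g × ∀ i → g i ∈ X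
choose {X = X} k≤∣X∣ =
  let f , f-inj , f∈X = embedding X in
  f ∘ (λ i → inject≤ i k≤∣X∣) , (λ eq → inject≤-injective _ _ _ _ (f-inj eq)) , λ i → f∈X _

enumerate : (s : Subset n) → ∣ s ∣ ≡ N → Σ (Fin N → Fin n) λ f → Injective _≡_ _≡_ f × range f ≡ s
enumerate s refl with embedding s
... | f , f-inj , f∈s = f , f-inj , p⊆q∧∣q∣≤∣p∣⇒p≡q range⊆s (≤-reflexive (sym (∣range∣≡R f f-inj)))
  where
  range⊆s : range f ⊆ s
  range⊆s y∈ = let j , fj≡y = ∈-range⁻ f y∈ in subst (_∈ s) fj≡y (f∈s j)

transpose-self : ∀ (i j : Fin n) → transpose i j i ≡ j
transpose-self i j rewrite dec-true (i ≟ i) refl = refl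

enumerate-at : (s : Subset n) → ∣ s ∣ ≡ N → ∀ {x} → x ∈ s → (c : Fin N) →
               Σ (Fin N → Fin n) λ q → Injective _≡_ _≡_ q × range q ≡ s × q c ≡ x
enumerate-at s ∣s∣≡N x∈s c with enumerate s ∣s∣≡N
... | f , f-inj , range-f≡s with ∈-range⁻ f (subst (_ ∈_) (sym range-f≡s) x∈s)
... | a , fa≡x = f ∘ transpose c a , q-inj , trans (range-∘ f transpose-onto) range-f≡s ,
                 trans (cong f (transpose-self c a)) fa≡x
  where
  q-inj : Injective _≡_ _≡_ (f ∘ transpose c a)
  q-inj {i} {j} eq = begin
    i                                ≡⟨ transpose-inverse a c ⟨
    transpose a c (transpose c a i)  ≡⟨ cong (transpose a c) (f-inj eq) ⟩
    transpose a c (transpose c a j)  ≡⟨ transpose-inverse a c ⟩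
    j                                ∎
    where open ≡-Reasoning
  transpose-onto : ∀ j → ∃ λ i → transpose c a i ≡ j
  transpose-onto j = transpose a c j , transpose-inverse c a

module _ {r : ℕ} (lab : Fin n → Fin r) where

  IsTransversal : (Fin r → Fin n) → Set
  IsTransversal x = ∀ j → lab (x j) ≡ j

  module _ {x : Fin r → Fin n} (x-tr : IsTransversal x) where

    transversal-injective : Injective _≡_ _≡_ x
    transversal-injective {i} {j} xi≡xj = trans (sym (x-tr i)) (trans (cong lab xi≡xj) (x-tr j))

    transversal-at : ∀ {y} → y ∈ range x → x (lab y) ≡ y
    transversal-at y∈ = let j , xj≡y = ∈-range⁻ x y∈ in
      trans (cong x (trans (cong lab (sym xj≡y)) (x-tr j))) xj≡y

    range∩part≡⁅⁆ : ∀ j → range x ∩ part lab j ≡ ⁅ x j ⁆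
    range∩part≡⁅⁆ j = ⊆-antisym
      (λ {y} y∈ → let y∈range , y∈part = x∈p∩q⁻ (range x) _ y∈ in
        subst (_∈ ⁅ x j ⁆) (trans (cong x (sym (∈-part⁻ lab y∈part))) (transversal-at y∈range)) (x∈⁅x⁆ (x j)))
      (λ y∈ → subst (_∈ range x ∩ part lab j) (sym (x∈⁅y⁆⇒x≡y _ y∈))
        (x∈p∩q⁺ (∈-range⁺ x j , ∈-part⁺ lab (x-tr j))))

    transversal⇒rainbow : Rainbow lab (range x)
    transversal⇒rainbow j = trans (cong ∣_∣ (range∩part≡⁅⁆ j)) (∣⁅x⁆∣≡1 (x j))

  rainbow⇒transversal : ∀ {f} → Rainbow lab f → ∃ λ x → IsTransversal x × range x ≡ f
  rainbow⇒transversal {f} rainbow = x , x-tr , range-unique x (λ j → proj₁ (x∈f∩part j)) onto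
    where
    x : Fin r → Fin n
    x j = proj₁ (∣p∣≡1⇒p≡⁅x⁆ (f ∩ part lab j) (rainbow j))
    f∩part≡⁅x⁆ : ∀ j → f ∩ part lab j ≡ ⁅ x j ⁆
    f∩part≡⁅x⁆ j = proj₂ (∣p∣≡1⇒p≡⁅x⁆ (f ∩ part lab j) (rainbow j))
    x∈f∩part : ∀ j → x j ∈ f × x j ∈ part lab j
    x∈f∩part j = x∈p∩q⁻ f _ (subst (x j ∈_) (sym (f∩part≡⁅x⁆ j)) (x∈⁅x⁆ (x j)))
    x-tr : IsTransversal x
    x-tr j = ∈-part⁻ lab (proj₂ (x∈f∩part j))
    onto : ∀ {y} → y ∈ f → ∃ λ j → x j ≡ y
    onto {y} y∈f = lab y , sym (x∈⁅y⁆⇒x≡y _ (subst (y ∈_) (f∩part≡⁅x⁆ (lab y)) (x∈p∩q⁺ (y∈f , ∈-part⁺ lab refl))))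

index : (m : Vec ℕ R) → Fin (Vec.sum m) → ℕ
index (a ∷ m) x with splitAt a x
... | inj₁ i = toℕ i
... | inj₂ y = index m y

index<lookup : (m : Vec ℕ R) (x : Fin (Vec.sum m)) → index m x < lookup m (label m x)
index<lookup (a ∷ m) x with splitAt a x
... | inj₁ i = toℕ<n i
... | inj₂ y = index<lookup m y

label-index-injective : (m : Vec ℕ R) {x y : Fin (Vec.sum m)} →
  label m x ≡ label m y → index m x ≡ index m y → x ≡ y
label-index-injective (a ∷ m) {x} {y} same-label same-index
  with splitAt a x in x≡ | splitAt a y in y≡
... | inj₁ i | inj₁ j = begin
  x                ≡⟨ splitAt⁻¹-↑ˡ x≡ ⟨
  i ↑ˡ Vec.sum m   ≡⟨ cong (_↑ˡ Vec.sum m) (toℕ-injective same-index) ⟩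
  j ↑ˡ Vec.sum m   ≡⟨ splitAt⁻¹-↑ˡ y≡ ⟩
  y                ∎
  where open ≡-Reasoning
... | inj₂ u | inj₂ v = begin
  x        ≡⟨ splitAt⁻¹-↑ʳ x≡ ⟨
  a ↑ʳ u   ≡⟨ cong (a ↑ʳ_) (label-index-injective m (suc-injective same-label) same-index) ⟩
  a ↑ʳ v   ≡⟨ splitAt⁻¹-↑ʳ y≡ ⟩
  y        ∎
  where open ≡-Reasoning

vertex-at : (m : Vec ℕ R) (j : Fin R) {t : ℕ} → t < lookup m j →
            ∃ λ x → label m x ≡ j × index m x ≡ t
vertex-at (a ∷ m) zero t<a = fromℕ< t<a ↑ˡ Vec.sum m , at
  where
  at : label (a ∷ m) (fromℕ< t<a ↑ˡ Vec.sum m) ≡ zero × index (a ∷ m) (fromℕ< t<a ↑ˡ Vec.sum m) ≡ _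
  at rewrite splitAt-↑ˡ a (fromℕ< t<a) (Vec.sum m) = refl , toℕ-fromℕ< t<a
vertex-at (a ∷ m) (suc j) t<lookup =
  let x , label≡j , index≡t = vertex-at m j t<lookup in a ↑ʳ x , at x label≡j index≡t
  where
  at : ∀ x → label m x ≡ j → index m x ≡ _ → label (a ∷ m) (a ↑ʳ x) ≡ suc j × index (a ∷ m) (a ↑ʳ x) ≡ _
  at x label≡j index≡t rewrite splitAt-↑ʳ a (Vec.sum m) x = cong suc label≡j , index≡t

module _ (K : Faces n) where

  maximal-extension : ∀ {ρ} → Acc _⊃_ ρ → K ρ → ¬ ¬ (∃ λ τ → Maximal K τ × ρ ⊆ τ)
  maximal-extension {ρ} (acc larger) Kρ no-extension = no-extension (ρ , (Kρ , ρ-maximal) , id)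
    where
    ρ-maximal : ∀ ρ′ → K ρ′ → ρ ⊆ ρ′ → ρ′ ≡ ρ
    ρ-maximal ρ′ Kρ′ ρ⊆ρ′ with ⊆⊎∃∉ ρ′ ρ
    ... | inj₁ ρ′⊆ρ = ⊆-antisym ρ′⊆ρ ρ⊆ρ′
    ... | inj₂ escape = ⊥-elim (maximal-extension (larger (ρ⊆ρ′ , escape)) Kρ′
            λ (τ , τ-maximal , ρ′⊆τ) → no-extension (τ , τ-maximal , ⊆-trans ρ⊆ρ′ ρ′⊆τ))

  -- Faces are not decidable, so ρ ⊆ τ is only available doubly negated; it is only ever used to
  -- refute that a set is a face.
  StarWithin : Subset n → Subset n → Set
  StarWithin σ τ = ∀ {ρ} → K ρ → σ ⊆ ρ → ¬ ¬ (ρ ⊆ τ)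

  unique-maximal⇒StarWithin : ∀ {σ τ} → (∀ τ′ → Maximal K τ′ → σ ⊆ τ′ → τ′ ≡ τ) → StarWithin σ τ
  unique-maximal⇒StarWithin unique {ρ} Kρ σ⊆ρ ρ⊈τ = maximal-extension (⊃-wellFounded ρ) Kρ
    λ (τ′ , τ′-maximal , ρ⊆τ′) → ρ⊈τ (subst (ρ ⊆_) (unique τ′ τ′-maximal (⊆-trans σ⊆ρ ρ⊆τ′)) ρ⊆τ′)

-- The copy of K_m sends the singleton part j ≢ c to q j and the t-th vertex of the large part c to
-- ω t; its edges are the petals range (petal s), and range (petal zero) is range q.
module Sunflower {R : ℕ} (q : Fin R → Fin n) (c : Fin R) (g : Fin k → Fin n)
  (q-injective : Injective _≡_ _≡_ q) (g-injective : Injective _≡_ _≡_ g) (g≢q : ∀ i j → g i ≢ q j) where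

  m : Vec ℕ R
  m = replicate R 1 [ c ]≔ (k + 1)

  ω : Fin (suc k) → Fin n
  ω = q c Vector.∷ g

  petal : Fin (suc k) → Fin R → Fin n
  petal s = updateAt q c (const (ω s))

  petal-c : ∀ s → petal s c ≡ ω s
  petal-c s = updateAt-updates c q

  petal-other : ∀ s {j} → j ≢ c → petal s j ≡ q j
  petal-other s j≢c = updateAt-minimal _ c q j≢c

  petal-zero : ∀ j → petal zero j ≡ q j
  petal-zero j with j ≟ c
  ... | yes refl = petal-c zero
  ... | no j≢c = petal-other zero j≢c

  ω≢q : ∀ s {j} → j ≢ c → ω s ≢ q j
  ω≢q zero j≢c qc≡qj = j≢c (sym (q-injective qc≡qj))
  ω≢q (suc i) _ = g≢q i _

  ω-injective : Injective _≡_ _≡_ ω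
  ω-injective = injective-∷ g-injective (λ i → g≢q i c)

  petal-injective : ∀ s → Injective _≡_ _≡_ (petal s)
  petal-injective s {i} {j} eq with i ≟ c | j ≟ c
  ... | yes refl | yes refl = refl
  ... | yes refl | no j≢c = contradiction (trans (sym (petal-c s)) (trans eq (petal-other s j≢c))) (ω≢q s j≢c)
  ... | no i≢c | yes refl = contradiction (trans (sym (petal-c s)) (trans (sym eq) (petal-other s i≢c))) (ω≢q s i≢c)
  ... | no i≢c | no j≢c = q-injective (trans (sym (petal-other s i≢c)) (trans eq (petal-other s j≢c)))

  lookup-m-c : lookup m c ≡ suc k
  lookup-m-c = trans (lookup∘update c (replicate R 1) (k + 1)) (+-comm k 1)

  lookup-m-other : ∀ {j} → j ≢ c → lookup m j ≡ 1
  lookup-m-other {j} j≢c = trans (lookup∘update′ j≢c (replicate R 1) (k + 1)) (lookup-replicate j 1)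

  index≡0 : ∀ {x} → label m x ≢ c → index m x ≡ 0
  index≡0 {x} ≢c = n<1⇒n≡0 (subst (index m x <_) (lookup-m-other ≢c) (index<lookup m x))

  index<1+k : ∀ x → index m x < suc k
  index<1+k x with label m x ≟ c
  ... | yes ≡c = subst (index m x <_) (trans (cong (lookup m) ≡c) lookup-m-c) (index<lookup m x)
  ... | no ≢c = subst (_< suc k) (sym (index≡0 ≢c)) (s≤s z≤n)

  slot : Fin (Vec.sum m) → Fin (suc k)
  slot x = fromℕ< (index<1+k x)

  φ : Fin (Vec.sum m) → Fin n
  φ x = petal (slot x) (label m x)

  φ-c : ∀ x → label m x ≡ c → φ x ≡ ω (slot x)
  φ-c x ≡c = trans (cong (petal (slot x)) ≡c) (petal-c (slot x))

  φ-other : ∀ x → label m x ≢ c → φ x ≡ q (label m x)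
  φ-other x = petal-other (slot x)

  φ-injective : Injective _≡_ _≡_ φ
  φ-injective {x} {y} eq with label m x ≟ c | label m y ≟ c
  ... | yes x≡c | yes y≡c = label-index-injective m (trans x≡c (sym y≡c)) (begin
    index m x       ≡⟨ toℕ-fromℕ< _ ⟨
    toℕ (slot x)    ≡⟨ cong toℕ (ω-injective (trans (sym (φ-c x x≡c)) (trans eq (φ-c y y≡c)))) ⟩
    toℕ (slot y)    ≡⟨ toℕ-fromℕ< _ ⟩
    index m y       ∎)
    where open ≡-Reasoning
  ... | yes x≡c | no y≢c = contradiction (trans (sym (φ-c x x≡c)) (trans eq (φ-other y y≢c))) (ω≢q (slot x) y≢c)
  ... | no x≢c | yes y≡c = contradiction (trans (sym (φ-c y y≡c)) (trans (sym eq) (φ-other x x≢c))) (ω≢q (slot y) x≢c)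
  ... | no x≢c | no y≢c = label-index-injective m same-label (trans (index≡0 x≢c) (sym (index≡0 y≢c)))
    where same-label = q-injective (trans (sym (φ-other x x≢c)) (trans eq (φ-other y y≢c)))

  φ∘transversal : ∀ {x} → IsTransversal (label m) x → ∀ j → φ (x j) ≡ petal (slot (x c)) j
  φ∘transversal {x} x-tr j with j ≟ c
  ... | yes refl = cong (petal (slot (x c))) (x-tr c)
  ... | no j≢c = begin
    φ (x j)               ≡⟨ φ-other (x j) (λ ≡c → j≢c (trans (sym (x-tr j)) ≡c)) ⟩
    q (label m (x j))     ≡⟨ cong q (x-tr j) ⟩
    q j                   ≡⟨ petal-other (slot (x c)) j≢c ⟨
    petal (slot (x c)) j  ∎
    where open ≡-Reasoning

  image-rainbow : ∀ {f} → Rainbow (label m) f → ∃ λ s → image φ f ≡ range (petal s)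
  image-rainbow {f} rainbow with rainbow⇒transversal (label m) {f} rainbow
  ... | x , x-tr , refl = slot (x c) , trans (image-range φ x) (range-cong (φ∘transversal x-tr))

  0<lookup-m : ∀ j → 0 < lookup m j
  0<lookup-m j with j ≟ c
  ... | yes refl = subst (0 <_) (sym lookup-m-c) (s≤s z≤n)
  ... | no j≢c = subst (0 <_) (sym (lookup-m-other j≢c)) (s≤s z≤n)

  base : Fin R → Fin (Vec.sum m)
  base j = proj₁ (vertex-at m j (0<lookup-m j))

  base-transversal : IsTransversal (label m) base
  base-transversal j = proj₁ (proj₂ (vertex-at m j (0<lookup-m j)))

  φ∘base : ∀ j → φ (base j) ≡ q j
  φ∘base j = trans (cong₂ petal slot≡0 (base-transversal j)) (petal-zero j)
    where
    slot≡0 : slot (base j) ≡ zero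
    slot≡0 = toℕ-injective (trans (toℕ-fromℕ< _) (proj₂ (proj₂ (vertex-at m j (0<lookup-m j)))))

  copy : (H : Hypergraph n) → (∀ i → H (range (petal (suc i)))) →
         CopyUsing (CompletePartite m) (H +ₑ range q) (range q)
  copy H petals = record
    { φ     = φ
    ; inj   = φ-injective
    ; edges = edge
    ; uses  = range base , transversal⇒rainbow (label m) base-transversal ,
              trans (image-range φ base) (range-cong φ∘base)
    }
    where
    edge : ∀ f → Rainbow (label m) f → (H +ₑ range q) (image φ f)
    edge f rainbow with image-rainbow rainbow
    ... | zero , image≡ = inj₂ (trans image≡ (range-cong petal-zero))
    ... | suc i , image≡ = inj₁ (subst H (sym image≡) (petals i))

  petal-transversal : (lab : Fin n → Fin R) → IsTransversal lab q → (∀ i → lab (g i) ≡ c) →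
                      ∀ s → IsTransversal lab (petal s)
  petal-transversal lab q-tr g-in-c s j with j ≟ c
  ... | yes refl = trans (cong lab (petal-c s)) (ω-in-c s)
    where
    ω-in-c : ∀ s → lab (ω s) ≡ c
    ω-in-c zero = q-tr c
    ω-in-c (suc i) = g-in-c i
  ... | no j≢c = trans (cong lab (petal-other s j≢c)) (q-tr j)

  copy-directed : (lab : Fin n → Fin R) → IsTransversal lab q → (∀ i → lab (g i) ≡ c) →
                  ∀ x → lab (φ x) ≡ label m x
  copy-directed lab q-tr g-in-c x = petal-transversal lab q-tr g-in-c (slot x) (label m x)

Closed : Faces n → Set
Closed {n} K = ∀ (σ τ : Subset n) → τ ⊆ σ → K σ → K τ

deleteStar-closed : ∀ {K : Faces n} {σ} → Closed K → Closed (deleteStar K σ)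
deleteStar-closed K-closed ρ ρ′ ρ′⊆ρ (Kρ , σ⊈ρ) = K-closed ρ ρ′ ρ′⊆ρ Kρ , λ σ⊆ρ′ → σ⊈ρ (⊆-trans σ⊆ρ′ ρ′⊆ρ)

_∖_ : Hypergraph n → Faces n → Hypergraph n
(G ∖ K) e = G e × ¬ K e

_⊑_ : Hypergraph n → Hypergraph n → Set
H ⊑ H′ = ∀ {e} → H e → H′ e

+ₑ-mono : ∀ {H H′ : Hypergraph n} {e} → H ⊑ H′ → (H +ₑ e) ⊑ (H′ +ₑ e)
+ₑ-mono H⊑H′ (inj₁ f∈H) = inj₁ (H⊑H′ f∈H)
+ₑ-mono H⊑H′ (inj₂ f≡e) = inj₂ f≡e

⊑-foldl-+ₑ : ∀ (H : Hypergraph n) es → H ⊑ foldl _+ₑ_ H es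
⊑-foldl-+ₑ H [] e∈H = e∈H
⊑-foldl-+ₑ H (e ∷ es) f∈H = ⊑-foldl-+ₑ (H +ₑ e) es (inj₁ f∈H)

∈⇒foldl-+ₑ : ∀ (H : Hypergraph n) {es e} → e ∈ₗ es → foldl _+ₑ_ H es e
∈⇒foldl-+ₑ H {_ ∷ es} (here refl) = ⊑-foldl-+ₑ _ es (inj₂ refl)
∈⇒foldl-+ₑ H {_ ∷ _} (there e∈es) = ∈⇒foldl-+ₑ _ e∈es

allSubsets : ∀ n → List (Subset n)
allSubsets zero = [] ∷ []
allSubsets (suc n) = map (inside ∷_) (allSubsets n) ++ map (outside ∷_) (allSubsets n)

∈-allSubsets : ∀ (s : Subset n) → s ∈ₗ allSubsets n
∈-allSubsets [] = here refl
∈-allSubsets (inside ∷ s) = ∈-++⁺ˡ (∈-map⁺ (inside ∷_) (∈-allSubsets s))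
∈-allSubsets {suc n} (outside ∷ s) = ∈-++⁺ʳ (map (inside ∷_) (allSubsets n)) (∈-map⁺ (outside ∷_) (∈-allSubsets s))

allSubsets-unique : ∀ n → Unique (allSubsets n)
allSubsets-unique zero = [] ∷ []
allSubsets-unique (suc n) = Unique.++⁺
  (Unique.map⁺ (proj₂ ∘ ∷-injective) (allSubsets-unique n))
  (Unique.map⁺ (proj₂ ∘ ∷-injective) (allSubsets-unique n))
  λ (s∈inside , s∈outside) → case ∈-map⁻ (inside ∷_) s∈inside , ∈-map⁻ (outside ∷_) s∈outside of λ where
    ((_ , _ , refl) , (_ , _ , ()))

module _ (Step : Hypergraph n → Subset n → Set) where

  Steps : Hypergraph n → List (Subset n) → Set
  Steps H [] = ⊤
  Steps H (e ∷ es) = Step H e × Steps (H +ₑ e) es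

  Saturates : Hypergraph n → Hypergraph n → Set
  Saturates H G = Σ (List (Subset n)) λ es →
    Unique es × (∀ e → (e ∈ₗ es) ⇔ (G e × ¬ H e)) × Steps H es

  Steps-++ : ∀ {H} es {es′} → Steps H es → Steps (foldl _+ₑ_ H es) es′ → Steps H (es ++ es′)
  Steps-++ [] _ steps′ = steps′
  Steps-++ (e ∷ es) (first , rest) steps′ = first , Steps-++ es rest steps′

  module _ (Step-mono : ∀ {H H′ e} → H ⊑ H′ → Step H e → Step H′ e) where

    Steps-mono : ∀ {H H′} es → H ⊑ H′ → Steps H es → Steps H′ es
    Steps-mono [] _ _ = _
    Steps-mono {H} {H′} (e ∷ es) H⊑H′ (first , rest) =
      Step-mono H⊑H′ first , Steps-mono es (+ₑ-mono {H = H} {H′} {e} H⊑H′) rest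

    Steps-each : ∀ {H} es → (∀ {e} → e ∈ₗ es → Step H e) → Steps H es
    Steps-each [] _ = _
    Steps-each (e ∷ es) each = each (here refl) , Steps-mono es inj₁ (Steps-each es (each ∘ there))

module CollapseSaturation (d : ℕ) (G : Hypergraph n) (G? : Decidable G)
  (Step : Hypergraph n → Subset n → Set) (Step-mono : ∀ {H H′ e} → H ⊑ H′ → Step H e → Step H′ e)
  (Bounded : Subset n → Set)
  (star-step : ∀ {K : Faces n} {σ τ e} → ∣ σ ∣ ≤ d → Bounded τ → StarWithin K σ τ →
               G e → σ ⊆ e → e ⊆ τ → Step (G ∖ K) e) where

  starEdges : Subset n → Subset n → List (Subset n)
  starEdges σ τ = filter (λ e → G? e ×-dec (σ ⊆? e ×-dec e ⊆? τ)) (allSubsets n)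

  module _ {σ τ : Subset n} where

    ∈-starEdges⁺ : ∀ {e} → G e × σ ⊆ e × e ⊆ τ → e ∈ₗ starEdges σ τ
    ∈-starEdges⁺ {e} = ∈-filter⁺ (λ e → G? e ×-dec (σ ⊆? e ×-dec e ⊆? τ)) (∈-allSubsets e)

    ∈-starEdges⁻ : ∀ {e} → e ∈ₗ starEdges σ τ → G e × σ ⊆ e × e ⊆ τ
    ∈-starEdges⁻ = proj₂ ∘ ∈-filter⁻ (λ e → G? e ×-dec (σ ⊆? e ×-dec e ⊆? τ)) {xs = allSubsets n}

  module _ {K : Faces n} {σ τ : Subset n} (K-closed : Closed K) (Kτ : K τ) (star : StarWithin K σ τ) where

    nonface-deleteStar : ∀ {e} → (G ∖ deleteStar K σ) e → (G ∖ K) e ⊎ e ∈ₗ starEdges σ τ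
    nonface-deleteStar {e} (Ge , ¬K′e) with σ ⊆? e
    ... | no σ⊈e = inj₁ (Ge , λ Ke → ¬K′e (Ke , σ⊈e))
    ... | yes σ⊆e with e ⊆? τ
    ... | yes e⊆τ = inj₂ (∈-starEdges⁺ (Ge , σ⊆e , e⊆τ))
    ... | no e⊈τ = inj₁ (Ge , λ Ke → star Ke σ⊆e e⊈τ)

    collapse-step : ∣ σ ∣ ≤ d → Bounded τ → Saturates Step (G ∖ deleteStar K σ) G → Saturates Step (G ∖ K) G
    collapse-step ∣σ∣≤d τ-bounded (es , es-unique , ∈es⇔ , es-steps) = starEdges σ τ ++ es , unique , ∈⇔ , steps
      where
      unique : Unique (starEdges σ τ ++ es)
      unique = Unique.++⁺ (Unique.filter⁺ _ (allSubsets-unique n)) es-unique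
        λ (e∈star , e∈es) → let Ge , σ⊆e , _ = ∈-starEdges⁻ e∈star in
          proj₂ (Equivalence.to (∈es⇔ _) e∈es) (Ge , λ (_ , σ⊈e) → σ⊈e σ⊆e)

      ∈⇔ : ∀ e → (e ∈ₗ starEdges σ τ ++ es) ⇔ (G e × ¬ (G ∖ K) e)
      ∈⇔ e = mk⇔ to from
        where
        to : e ∈ₗ starEdges σ τ ++ es → G e × ¬ (G ∖ K) e
        to e∈ with ∈-++⁻ (starEdges σ τ) e∈
        ... | inj₁ e∈star = let Ge , _ , e⊆τ = ∈-starEdges⁻ e∈star in
          Ge , λ (_ , ¬Ke) → ¬Ke (K-closed τ e e⊆τ Kτ)
        ... | inj₂ e∈es = let Ge , ¬nonface′ = Equivalence.to (∈es⇔ e) e∈es in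
          Ge , λ (_ , ¬Ke) → ¬nonface′ (Ge , ¬Ke ∘ proj₁)
        from : G e × ¬ (G ∖ K) e → e ∈ₗ starEdges σ τ ++ es
        from (Ge , ¬nonface) with σ ⊆? e ×-dec e ⊆? τ
        ... | yes (σ⊆e , e⊆τ) = ∈-++⁺ˡ (∈-starEdges⁺ (Ge , σ⊆e , e⊆τ))
        ... | no ∉star = ∈-++⁺ʳ _ (Equivalence.from (∈es⇔ e) (Ge , λ nonface′ →
          case nonface-deleteStar nonface′ of λ where
            (inj₁ nonface) → ¬nonface nonface
            (inj₂ e∈star) → ∉star (proj₂ (∈-starEdges⁻ e∈star))))

      steps : Steps Step (G ∖ K) (starEdges σ τ ++ es)
      steps = Steps-++ Step (starEdges σ τ)
        (Steps-each Step Step-mono _ λ e∈star → let Ge , σ⊆e , e⊆τ = ∈-starEdges⁻ e∈star in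
          star-step ∣σ∣≤d τ-bounded star Ge σ⊆e e⊆τ)
        (Steps-mono Step Step-mono es
          (λ nonface′ → [ ⊑-foldl-+ₑ (G ∖ K) (starEdges σ τ) , ∈⇒foldl-+ₑ (G ∖ K) ]′ (nonface-deleteStar nonface′))
          es-steps)

  saturates : ∀ {K} → Collapsible d K → Closed K → (∀ {ρ} → K ρ → Bounded ρ) → Saturates Step (G ∖ K) G
  saturates (done no-faces) _ _ = [] , [] , (λ e → mk⇔ (λ ()) λ (Ge , ¬nonface) → ⊥-elim (¬nonface (Ge , no-faces e))) , _
  saturates (step σ _ ∣σ∣≤d (τ , ((Kτ , _) , _) , unique) collapse) K-closed bounded =
    collapse-step K-closed Kτ (unique-maximal⇒StarWithin _ unique) ∣σ∣≤d (bounded Kτ)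
      (saturates collapse (deleteStar-closed K-closed) (bounded ∘ proj₁))

copy-mono : ∀ {N} {F : Hypergraph N} {H H′ : Hypergraph n} {e} →
            H ⊑ H′ → CopyUsing F (H +ₑ e) e → CopyUsing F (H′ +ₑ e) e
copy-mono {H = H} {H′} {e} H⊑H′ cp = record
  { φ = φ ; inj = inj ; edges = λ f Ff → +ₑ-mono {H = H} {H′} {e} H⊑H′ (edges f Ff) ; uses = uses }
  where open CopyUsing cp

module _ {I : Set} (N : I → ℕ) (F : (i : I) → Hypergraph (N i)) where

  CopyStep : Hypergraph n → Subset n → Set
  CopyStep H e = ∃ λ i → CopyUsing (F i) (H +ₑ e) e

  CopyStep-mono : ∀ {H H′ : Hypergraph n} {e} → H ⊑ H′ → CopyStep H e → CopyStep H′ e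
  CopyStep-mono H⊑H′ (i , cp) = i , copy-mono H⊑H′ cp

  Saturates⇒WeaklySaturated : ∀ {H G : Hypergraph n} → Saturates CopyStep H G → WeaklySaturated N F H G
  Saturates⇒WeaklySaturated (es , es-unique , ∈es⇔ , steps) = es , es-unique , ∈es⇔ , satSteps es steps
    where
    satSteps : ∀ {H} es → Steps CopyStep H es → SatSteps N F H es
    satSteps [] _ = _
    satSteps (e ∷ es) (first , rest) = first , satSteps es rest

  module _ {r : ℕ} (labF : (i : I) → Fin (N i) → Fin r) (labG : Fin n → Fin r) where

    DirectedCopyStep : Hypergraph n → Subset n → Set
    DirectedCopyStep H e = ∃ λ i → DirectedCopyUsing (F i) (labF i) (H +ₑ e) labG e

    DirectedCopyStep-mono : ∀ {H H′ : Hypergraph n} {e} → H ⊑ H′ → DirectedCopyStep H e → DirectedCopyStep H′ e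
    DirectedCopyStep-mono H⊑H′ (i , cp) =
      i , record { copy = copy-mono H⊑H′ (DirectedCopyUsing.copy cp) ; directed = DirectedCopyUsing.directed cp }

    Saturates⇒DirectedWeaklySaturated : ∀ {H G : Hypergraph n} → Saturates DirectedCopyStep H G →
                                         DirectedWeaklySaturated N F labF labG H G
    Saturates⇒DirectedWeaklySaturated (es , es-unique , ∈es⇔ , steps) = es , es-unique , ∈es⇔ , dirSatSteps es steps
      where
      dirSatSteps : ∀ {H} es → Steps DirectedCopyStep H es → DirSatSteps N F labF labG H es
      dirSatSteps [] _ = _
      dirSatSteps (e ∷ es) (first , rest) = first , dirSatSteps es rest

module StarSunflower {K : Faces n} {σ τ : Subset n} (star : StarWithin K σ τ)
  {R : ℕ} (q : Fin R → Fin n) (q-injective : Injective _≡_ _≡_ q) (σ⊆q : σ ⊆ range q) (q⊆τ : range q ⊆ τ)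
  (c : Fin R) (qc∉σ : q c ∉ σ) (g : Fin k → Fin n) (g-injective : Injective _≡_ _≡_ g) (g∉τ : ∀ i → g i ∉ τ) where

  g≢q : ∀ i j → g i ≢ q j
  g≢q i j gi≡qj = g∉τ i (subst (_∈ τ) (sym gi≡qj) (q⊆τ (∈-range⁺ q j)))

  open Sunflower q c g q-injective g-injective g≢q public

  petal-nonface : ∀ i → ¬ K (range (petal (suc i)))
  petal-nonface i K-petal = star K-petal σ⊆petal (λ petal⊆τ → g∉τ i (petal⊆τ gi∈petal))
    where
    gi∈petal : g i ∈ range (petal (suc i))
    gi∈petal = subst (_∈ range (petal (suc i))) (petal-c (suc i)) (∈-range⁺ (petal (suc i)) c)
    σ⊆petal : σ ⊆ range (petal (suc i))
    σ⊆petal {y} y∈σ with ∈-range⁻ q (σ⊆q y∈σ)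
    ... | j , qj≡y with j ≟ c
    ... | yes refl = contradiction (subst (_∈ σ) (sym qj≡y) y∈σ) qc∉σ
    ... | no j≢c = subst (_∈ range (petal (suc i))) (trans (petal-other (suc i) j≢c) qj≡y) (∈-range⁺ (petal (suc i)) j)

  nonface-copy : (G : Hypergraph n) → (∀ s → G (range (petal s))) →
                 CopyUsing (CompletePartite m) ((G ∖ K) +ₑ range q) (range q)
  nonface-copy G G-petal = copy (G ∖ K) (λ i → G-petal (suc i) , petal-nonface i)

replicate-∷ʳ≡update : ∀ {A : Set} d (x y : A) → replicate d x ∷ʳ y ≡ replicate (suc d) x [ fromℕ d ]≔ y
replicate-∷ʳ≡update zero x y = refl
replicate-∷ʳ≡update (suc d) x y = cong (x ∷_) (replicate-∷ʳ≡update d x y)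

module _ {n : ℕ} (d r : ℕ) where

  private
    G : Hypergraph n
    G = Complete (suc d) n

    m : Vec ℕ (suc d)
    m = replicate d 1 ∷ʳ (n ∸ d ∸ r + 1)

  n∸d∸r≤∣∁τ∣ : ∀ (τ : Subset n) → ∣ τ ∣ ≤ d + r → n ∸ d ∸ r ≤ ∣ ∁ τ ∣
  n∸d∸r≤∣∁τ∣ τ ∣τ∣≤d+r = begin
    n ∸ d ∸ r    ≡⟨ ∸-+-assoc n d r ⟩
    n ∸ (d + r)  ≤⟨ ∸-monoʳ-≤ n ∣τ∣≤d+r ⟩
    n ∸ ∣ τ ∣    ≡⟨ ∣∁p∣≡n∸∣p∣ τ ⟨
    ∣ ∁ τ ∣      ∎
    where open ≤-Reasoning

  complete-star-step : ∀ {K : Faces n} {σ τ e} → ∣ σ ∣ ≤ d → ∣ τ ∣ ≤ d + r → StarWithin K σ τ →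
                       G e → σ ⊆ e → e ⊆ τ → CopyUsing (CompletePartite m) ((G ∖ K) +ₑ e) e
  complete-star-step {K} {σ} {τ} {e} ∣σ∣≤d ∣τ∣≤d+r star ∣e∣≡1+d σ⊆e e⊆τ =
    let w , w∈e , w∉σ = ∣p∣<∣q∣⇒∃∈q─p {p = σ} {e} (subst (∣ σ ∣ <_) (sym ∣e∣≡1+d) (s≤s ∣σ∣≤d))
        q , q-injective , range-q≡e , q-last≡w = enumerate-at e ∣e∣≡1+d w∈e (fromℕ d)
        g , g-injective , g∈∁τ = choose {X = ∁ τ} (n∸d∸r≤∣∁τ∣ τ ∣τ∣≤d+r)
        open StarSunflower star q q-injective (subst (σ ⊆_) (sym range-q≡e) σ⊆e)
               (subst (_⊆ τ) (sym range-q≡e) e⊆τ) (fromℕ d) (subst (_∉ σ) (sym q-last≡w) w∉σ)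
               g g-injective (x∈∁p⇒x∉p ∘ g∈∁τ)
    in subst₂ (λ m e → CopyUsing (CompletePartite m) ((G ∖ K) +ₑ e) e)
         (sym (replicate-∷ʳ≡update d 1 (n ∸ d ∸ r + 1))) range-q≡e
         (nonface-copy G (λ s → ∣range∣≡R (petal s) (petal-injective s)))

  complete-weaklySaturated : (K : SimplicialComplex n) → DCollapsible d K → (∀ σ → face K σ → ∣ σ ∣ ≤ d + r) →
    WeaklySaturated {I = ⊤} (λ _ → Vec.sum m) (λ _ → CompletePartite m) (G ∖ face K) G
  complete-weaklySaturated K collapsible bounded =
    Saturates⇒WeaklySaturated size F (saturates collapsible (closed K) (bounded _))
    where
    size : ⊤ → ℕ
    size _ = Vec.sum m
    F : (i : ⊤) → Hypergraph (size i)
    F _ = CompletePartite m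
    open CollapseSaturation d G (λ e → ∣ e ∣ ℕ.≟ suc d) (CopyStep size F) (CopyStep-mono size F) (λ τ → ∣ τ ∣ ≤ d + r)
      (λ ∣σ∣≤d ∣τ∣≤d+r star Ge σ⊆e e⊆τ → _ , complete-star-step ∣σ∣≤d ∣τ∣≤d+r star Ge σ⊆e e⊆τ)

module _ {n d : ℕ} (lab : Fin n → Fin (suc d)) (r : Fin (suc d) → ℕ) where

  private
    G : Hypergraph n
    G = Rainbow lab

    m : Fin (suc d) → Vec ℕ (suc d)
    m i = replicate (suc d) 1 [ i ]≔ (∣ part lab i ∣ ∸ r i + 1)

    PartBounded : Subset n → Set
    PartBounded τ = ∀ i → ∣ part lab i ∩ τ ∣ ≤ r i


  rainbow-star-step : ∀ {K : Faces n} {σ τ e} → ∣ σ ∣ ≤ d → PartBounded τ → StarWithin K σ τ →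
    G e → σ ⊆ e → e ⊆ τ →
    DirectedCopyStep (λ i → Vec.sum (m i)) (λ i → CompletePartite (m i)) (λ i → label (m i)) lab (G ∖ K) e
  rainbow-star-step {K} {σ} {τ} {e} ∣σ∣≤d τ-bounded star rainbow σ⊆e e⊆τ =
    let q , q-tr , range-q≡e = rainbow⇒transversal lab {e} rainbow
        q-injective = transversal-injective lab q-tr
        ∣e∣≡1+d = trans (cong ∣_∣ (sym range-q≡e)) (∣range∣≡R q q-injective)
        w , w∈e , w∉σ = ∣p∣<∣q∣⇒∃∈q─p {p = σ} {e} (subst (∣ σ ∣ <_) (sym ∣e∣≡1+d) (s≤s ∣σ∣≤d))
        c = lab w
        g , g-injective , g∈part∖τ = choose {X = part lab c ∩ ∁ τ} (∣p∩q∣≤b⇒∣p∣∸b≤∣p∩∁q∣ (part lab c) τ (τ-bounded c))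
        g-in-c = λ i → ∈-part⁻ lab (proj₁ (x∈p∩q⁻ _ _ (g∈part∖τ i)))
        open StarSunflower star q q-injective (subst (σ ⊆_) (sym range-q≡e) σ⊆e)
               (subst (_⊆ τ) (sym range-q≡e) e⊆τ)
               c (subst (_∉ σ) (sym (transversal-at lab q-tr (subst (w ∈_) (sym range-q≡e) w∈e))) w∉σ)
               g g-injective (λ i → x∈∁p⇒x∉p (proj₂ (x∈p∩q⁻ _ _ (g∈part∖τ i))))
          using (nonface-copy; petal-transversal; copy-directed)
    in c , subst (λ e → DirectedCopyUsing (CompletePartite (m c)) (label (m c)) ((G ∖ K) +ₑ e) lab e) range-q≡e
      (record
        { copy     = nonface-copy G (λ s → transversal⇒rainbow lab (petal-transversal lab q-tr g-in-c s))
        ; directed = copy-directed lab q-tr g-in-c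
        })

  rainbow-directedWeaklySaturated : (K : SimplicialComplex n) → DCollapsible d K →
    (∀ i σ → σ ⊆ part lab i → face K σ → ∣ σ ∣ ≤ r i) →
    DirectedWeaklySaturated (λ i → Vec.sum (m i)) (λ i → CompletePartite (m i)) (λ i → label (m i)) lab
      (G ∖ face K) G
  rainbow-directedWeaklySaturated K collapsible bounded =
    Saturates⇒DirectedWeaklySaturated _ _ _ _ (saturates collapsible (closed K) part-bounded)
    where
    part-bounded : ∀ {τ} → face K τ → PartBounded τ
    part-bounded Kτ i = bounded i _ (p∩q⊆p _ _) (closed K _ _ (p∩q⊆q _ _) Kτ)
    open CollapseSaturation d G (λ e → all? (λ i → ∣ e ∩ part lab i ∣ ℕ.≟ 1))
      (DirectedCopyStep _ _ _ _) (DirectedCopyStep-mono _ _ _ _) PartBounded rainbow-star-step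

theorem1p5 : (d : ℕ) →
  ((n r : ℕ) → d + r ≤ n → (K : SimplicialComplex n) → DCollapsible d K →
    (∀ σ → face K σ → ∣ σ ∣ ≤ d + r) →
    let m : Vec ℕ (suc d)
        m = replicate d 1 ∷ʳ (n ∸ d ∸ r + 1)
    in WeaklySaturated {I = ⊤} (λ _ → Vec.sum m) (λ _ → CompletePartite m)
         (λ e → Complete (suc d) n e × ¬ face K e) (Complete (suc d) n))
  × ((n : ℕ) (lab : Fin n → Fin (suc d)) (r : Fin (suc d) → ℕ) →
    (∀ i → r i ≤ ∣ part lab i ∣) →
    (K : SimplicialComplex n) → DCollapsible d K →
    (∀ i σ → σ ⊆ part lab i → face K σ → ∣ σ ∣ ≤ r i) →
    let m : Fin (suc d) → Vec ℕ (suc d)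
        m i = replicate (suc d) 1 [ i ]≔ (∣ part lab i ∣ ∸ r i + 1)
    in DirectedWeaklySaturated (λ i → Vec.sum (m i)) (λ i → CompletePartite (m i))
         (λ i → label (m i)) lab
         (λ e → Rainbow lab e × ¬ face K e) (Rainbow lab))
theorem1p5 d =
  (λ n r _ → complete-weaklySaturated d r) ,
  (λ n lab r _ → rainbow-directedWeaklySaturated lab r)
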